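{- For every integer $i\ge1$, coefficientwise in $\mathbb{Z}[m,r][[s]]$, $$\lim_{n\to\infty}\mathcal{Z}_n(i)=\prod_{j=1}^{i}\chi(m,rs^{j-1},s),\qquad\text{where } \mathcal{Z}_n(i)=\frac{G^{(s)}_{n-i}(m,rs^{i},s)}{G^{(s)}_{n}(m,r,s)}\ (n\ge i).$$
   Context: For an integer $n\ge0$ and $S\subseteq\{1,\dots,n\}$, let $|S|$ be its size, $\sigma(S)=\sum_{i\in S}i$, and $c(S)$ the number of maximal runs of consecutive integers in $S$. Define $G_n^{(s)}(m,r,s)=\sum_{S\subseteq\{1,\dots,n\}} s^{\sigma(S)}r^{|S|}m^{c(S)}(m-1)^{|S|-c(S)}$; it has constant term $1$ in $s$, so the quotient $\mathcal{Z}_n(i)$ (the emptiness formation probability: the weighted proportion of configurations with no dimer at positions $1,\dots,i$) is an element of $\mathbb{Z}[m,r][[s]]$. Let $f(x)=1+x(m-1)$ and let $\chi(m,r,s)$ be the unique formal power series in $r$ with coefficients in $\mathbb{Z}[m,s]$ satisfying $f(rs)\chi(m,r,s)=1-rs\,\chi(m,rs,s)\,\chi(m,r,s)$. -}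

module Defs where

open import Data.Bool using (Bool; true; false; if_then_else_; _∧_)
open import Data.Nat as ℕ using (ℕ; zero; suc; _∸_; _≡ᵇ_; _≤ᵇ_)
open import Data.Integer using (ℤ; +_; 0ℤ; 1ℤ; -_; _+_; _-_; _*_)
open import Data.List using (List; []; _∷_; map)
open import Data.Vec using (Vec; []; _∷_)
open import Relation.Binary.PropositionalEquality using (_≡_)
import Data.List

-- A series F is represented by its coefficient function:
--   F a b c = coefficient of m^a r^b s^c.
-- Z[m,r][[s]] and Z[m,s][[r]] both embed (as rings) into this ring
-- Z[[m,r,s]], and all ring operations below are the usual ones.

T : Set
T = ℕ → ℕ → ℕ → ℤ

_≈_ : T → T → Set
F ≈ G = ∀ a b c → F a b c ≡ G a b c
infix 4 _≈_

sumTo : ℕ → (ℕ → ℤ) → ℤ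
sumTo zero    f = f zero
sumTo (suc n) f = sumTo n f + f (suc n)

mono : ℕ → ℕ → ℕ → T
mono a b c a' b' c' = if (a ≡ᵇ a') ∧ ((b ≡ᵇ b') ∧ (c ≡ᵇ c')) then 1ℤ else 0ℤ

one : T
one = mono 0 0 0

mV : T
mV = mono 1 0 0

_⊕_ : T → T → T
(F ⊕ G) a b c = F a b c + G a b c

⊖_ : T → T
(⊖ F) a b c = - F a b c

_⊝_ : T → T → T
F ⊝ G = F ⊕ (⊖ G)

_⊗_ : T → T → T
(F ⊗ G) a b c =
  sumTo a λ a₁ → sumTo b λ b₁ → sumTo c λ c₁ →
    F a₁ b₁ c₁ * G (a ∸ a₁) (b ∸ b₁) (c ∸ c₁)

infixl 6 _⊕_ _⊝_
infixl 7 _⊗_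

_^T_ : T → ℕ → T
F ^T zero  = one
F ^T suc k = F ⊗ (F ^T k)

-- substitution r ↦ r s^j :  (substR j F)(m,r,s) = F(m, r s^j, s)
substR : ℕ → T → T
substR j F a b c = if (j ℕ.* b) ≤ᵇ c then F a b (c ∸ (j ℕ.* b)) else 0ℤ

-- Subsets of {1,…,n} as Vec Bool n (entry k ↔ element k+1).

allSubsets : (n : ℕ) → List (Vec Bool n)
allSubsets zero    = [] ∷ []
allSubsets (suc n) =
  Data.List._++_ (map (false ∷_) (allSubsets n)) (map (true ∷_) (allSubsets n))

size : ∀ {n} → Vec Bool n → ℕ
size []           = 0
size (true  ∷ v)  = suc (size v)
size (false ∷ v)  = size v

-- σ(S) where the head of the vector is element `off`
sigmaFrom : ∀ {n} → ℕ → Vec Bool n → ℕ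
sigmaFrom off []          = 0
sigmaFrom off (true  ∷ v) = off ℕ.+ sigmaFrom (suc off) v
sigmaFrom off (false ∷ v) = sigmaFrom (suc off) v

sigma : ∀ {n} → Vec Bool n → ℕ
sigma = sigmaFrom 1

-- number of maximal runs: count k ∈ S with k-1 ∉ S (or k = 1);
-- the Bool argument records whether the previous element is in S
runsFrom : ∀ {n} → Bool → Vec Bool n → ℕ
runsFrom prev []          = 0
runsFrom true  (true ∷ v) = runsFrom true v
runsFrom false (true ∷ v) = suc (runsFrom true v)
runsFrom prev (false ∷ v) = runsFrom false v

runs : ∀ {n} → Vec Bool n → ℕ
runs = runsFrom false

sumT : List T → T
sumT []       = λ _ _ _ → 0ℤ
sumT (F ∷ Fs) = F ⊕ sumT Fs

weight : ∀ {n} → Vec Bool n → T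
weight S = mono 0 (size S) (sigma S) ⊗ (mV ^T runs S) ⊗ ((mV ⊝ one) ^T (size S ∸ runs S))

G : ℕ → T
G n = sumT (map weight (allSubsets n))

-- Inverse in Z[m,r][[s]] of a series whose s^0-coefficient is 1.
-- Polynomials in m,r:
P : Set
P = ℕ → ℕ → ℤ

_⊗P_ : P → P → P
(p ⊗P q) a b = sumTo a λ a₁ → sumTo b λ b₁ → p a₁ b₁ * q (a ∸ a₁) (b ∸ b₁)

0P 1P : P
0P _ _ = 0ℤ
1P a b = if (a ≡ᵇ 0) ∧ (b ≡ᵇ 0) then 1ℤ else 0ℤ

sCoeff : T → ℕ → P
sCoeff F c a b = F a b c

convStep : T → ℕ → List P → P
convStep F t []       = 0P
convStep F t (p ∷ ps) a b = (sCoeff F (suc t) ⊗P p) a b + convStep F (suc t) ps a b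

-- invUpTo F k = [inv_k, inv_{k-1}, …, inv_0], with inv_0 = 1 and
-- inv_{k+1} = - Σ_{j=1}^{k+1} F_j * inv_{k+1-j}
invUpTo : T → ℕ → List P
invUpTo F zero    = 1P ∷ []
invUpTo F (suc k) = (λ a b → - convStep F 0 (invUpTo F k) a b) ∷ invUpTo F k

headP : List P → P
headP []      = 0P
headP (p ∷ _) = p

invS : T → T
invS F a b c = headP (invUpTo F c) a b

EFP : ℕ → ℕ → T
EFP n i = substR i (G (n ∸ i)) ⊗ invS (G n)

rs : T
rs = mono 0 1 1

fRS : T
fRS = one ⊕ rs ⊗ (mV ⊝ one)

IsChi : T → Set
IsChi χ = fRS ⊗ χ ≈ one ⊝ rs ⊗ substR 1 χ ⊗ χ

prodChi : T → ℕ → T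
prodChi χ zero    = one
prodChi χ (suc i) = prodChi χ i ⊗ substR i χ

module Submission where

-- Splitting off the element 1 of S gives G_{n+1}(r) = G_n(rs) + rs c G′_n(rs), where c = m or m - 1
-- according as 1 starts a new run or continues one (G′ counts 0 as an element of S); eliminating G′
-- yields G_{n+2}(r) = f(rs) G_{n+1}(rs) + rs G_n(rs²). Together with the functional equation, which
-- says that χ inverts 1 + rs (m - 1 + χ(rs)), this shows that the defect χ G_{n+1}(r) - G_n(rs)
-- vanishes below s^n. Applying r ↦ r s^j to these congruences and multiplying them gives
-- Π_{j<i} χ(r s^j) G_{n+i}(r) ≡ G_n(r s^i), and dividing by G_{n+i}, whose s^0-coefficient is 1,
-- gives Z_{n+i}(i) ≡ Π_{j<i} χ(r s^j) modulo s^n.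

open import Level using (0ℓ)
open import Algebra.Bundles using (CommutativeRing)
open import Relation.Binary.Bundles using (Setoid)
open import Algebra.Structures using (IsCommutativeRing)
open import Data.Bool using (Bool; true; false; if_then_else_)
open import Data.Nat as ℕ using (ℕ; zero; suc; _≤_; _≡ᵇ_; _≤ᵇ_; _∸_)
open import Data.Product using (∃-syntax; _,_)
open import Relation.Binary.PropositionalEquality as ≡ using (_≡_)
import Relation.Binary.Reasoning.Setoid

module _ (R : CommutativeRing 0ℓ 0ℓ) where
  open CommutativeRing R

  sumUpTo : ℕ → (ℕ → Carrier) → Carrier
  sumUpTo zero    h = h 0
  sumUpTo (suc n) h = sumUpTo n h + h (suc n)

  sumUpTo-front : ∀ n h → sumUpTo (suc n) h ≈ h 0 + sumUpTo n (λ i → h (suc i))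
  sumUpTo-front zero    h = refl
  sumUpTo-front (suc n) h = trans (+-congʳ (sumUpTo-front n h)) (+-assoc _ _ _)

  isCommutativeRing-via : (_∙_ : Carrier → Carrier → Carrier) (e : Carrier) →
    (∀ x y → (x ∙ y) ≈ (x * y)) → e ≈ 1# → IsCommutativeRing _≈_ _+_ _∙_ -_ 0# e
  isCommutativeRing-via _∙_ e ∙≈* e≈1 = record
    { isRing = record
      { +-isAbelianGroup = +-isAbelianGroup
      ; *-cong = λ p q → trans (∙≈* _ _) (trans (*-cong p q) (sym (∙≈* _ _)))
      ; *-assoc = λ x y z → trans (∙≈* _ _) (trans (*-congʳ (∙≈* x y))
          (trans (*-assoc x y z) (sym (trans (∙≈* _ _) (*-congˡ (∙≈* y z))))))
      ; *-identity = (λ x → trans (∙≈* e x) (trans (*-congʳ e≈1) (*-identityˡ x)))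
                   , (λ x → trans (∙≈* x e) (trans (*-congˡ e≈1) (*-identityʳ x)))
      ; distrib =
          (λ x y z → trans (∙≈* _ _) (trans (distribˡ x y z) (sym (+-cong (∙≈* x y) (∙≈* x z)))))
        , (λ x y z → trans (∙≈* _ _) (trans (distribʳ x y z) (sym (+-cong (∙≈* y x) (∙≈* z x)))))
      }
    ; *-comm = λ x y → trans (∙≈* x y) (trans (*-comm x y) (sym (∙≈* y x)))
    }

module PowerSeries (R : CommutativeRing 0ℓ 0ℓ) where
  open CommutativeRing R
  open import Relation.Binary.Reasoning.Setoid setoid
  open import Algebra.Properties.CommutativeSemigroup +-commutativeSemigroup
    using () renaming (interchange to +-interchange)
  open import Algebra.Properties.CommutativeSemigroup *-commutativeSemigroup
    using (xy∙z≈y∙xz; x∙yz≈yx∙z) renaming (interchange to *-interchange)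

  Series : Set
  Series = ℕ → Carrier

  infix 4 _≋_
  _≋_ : Series → Series → Set
  f ≋ g = ∀ n → f n ≈ g n

  infixl 6 _⊞_
  infixl 7 _⋆_ _·_

  _⊞_ : Series → Series → Series
  (f ⊞ g) n = f n + g n

  ⊟_ : Series → Series
  (⊟ f) n = - f n

  𝟘 : Series
  𝟘 _ = 0#

  monomial : ℕ → Carrier → Series
  monomial d x n = if d ≡ᵇ n then x else 0#

  𝟙 : Series
  𝟙 = monomial 0 1#

  tail : Series → Series
  tail f n = f (suc n)

  _·_ : Carrier → Series → Series
  (x · f) n = x * f n

  _⋆_ : Series → Series → Series
  (f ⋆ g) zero    = f 0 * g 0
  (f ⋆ g) (suc n) = f 0 * g (suc n) + (tail f ⋆ g) n

  ⋆-cong : ∀ {f f′ g g′} → f ≋ f′ → g ≋ g′ → f ⋆ g ≋ f′ ⋆ g′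
  ⋆-cong p q zero    = *-cong (p 0) (q 0)
  ⋆-cong p q (suc n) = +-cong (*-cong (p 0) (q (suc n))) (⋆-cong (λ k → p (suc k)) q n)

  ⋆-zeroˡ : ∀ g → 𝟘 ⋆ g ≋ 𝟘
  ⋆-zeroˡ g zero    = zeroˡ (g 0)
  ⋆-zeroˡ g (suc n) = trans (+-cong (zeroˡ _) (⋆-zeroˡ g n)) (+-identityˡ 0#)

  ⋆-distribʳ : ∀ f f′ g → (f ⊞ f′) ⋆ g ≋ f ⋆ g ⊞ f′ ⋆ g
  ⋆-distribʳ f f′ g zero    = distribʳ (g 0) (f 0) (f′ 0)
  ⋆-distribʳ f f′ g (suc n) =
    trans (+-cong (distribʳ _ _ _) (⋆-distribʳ (tail f) (tail f′) g n)) (+-interchange _ _ _ _)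

  ·-⋆-assoc : ∀ x f g → (x · f) ⋆ g ≋ x · (f ⋆ g)
  ·-⋆-assoc x f g zero    = *-assoc x (f 0) (g 0)
  ·-⋆-assoc x f g (suc n) =
    trans (+-cong (*-assoc _ _ _) (·-⋆-assoc x (tail f) g n)) (sym (distribˡ x _ _))

  ⋆-suc-tailʳ : ∀ f g n → (f ⋆ g) (suc n) ≈ (f ⋆ tail g) n + f (suc n) * g 0
  ⋆-suc-tailʳ f g zero    = refl
  ⋆-suc-tailʳ f g (suc n) =
    trans (+-congˡ (⋆-suc-tailʳ (tail f) g n)) (sym (+-assoc _ _ _))

  ⋆-comm : ∀ f g → f ⋆ g ≋ g ⋆ f
  ⋆-comm f g zero    = *-comm (f 0) (g 0)
  ⋆-comm f g (suc n) = begin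
    f 0 * g (suc n) + (tail f ⋆ g) n ≈⟨ +-cong (*-comm _ _) (⋆-comm (tail f) g n) ⟩
    g (suc n) * f 0 + (g ⋆ tail f) n ≈⟨ +-comm _ _ ⟩
    (g ⋆ tail f) n + g (suc n) * f 0 ≈⟨ ⋆-suc-tailʳ g f n ⟨
    (g ⋆ f) (suc n)                  ∎

  ⋆-identityˡ : ∀ f → 𝟙 ⋆ f ≋ f
  ⋆-identityˡ f zero    = *-identityˡ (f 0)
  ⋆-identityˡ f (suc n) =
    trans (+-cong (*-identityˡ _) (⋆-zeroˡ f n)) (+-identityʳ _)

  ⋆-assoc : ∀ f g h → (f ⋆ g) ⋆ h ≋ f ⋆ (g ⋆ h)
  ⋆-assoc f g h zero    = *-assoc (f 0) (g 0) (h 0)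
  ⋆-assoc f g h (suc n) = begin
    f 0 * g 0 * h (suc n) + ((f 0 · tail g ⊞ tail f ⋆ g) ⋆ h) n
      ≈⟨ +-congˡ (⋆-distribʳ (f 0 · tail g) (tail f ⋆ g) h n) ⟩
    f 0 * g 0 * h (suc n) + (((f 0 · tail g) ⋆ h) n + ((tail f ⋆ g) ⋆ h) n)
      ≈⟨ +-congˡ (+-cong (·-⋆-assoc (f 0) (tail g) h n) (⋆-assoc (tail f) g h n)) ⟩
    f 0 * g 0 * h (suc n) + (f 0 * (tail g ⋆ h) n + (tail f ⋆ (g ⋆ h)) n)
      ≈⟨ +-assoc _ _ _ ⟨
    f 0 * g 0 * h (suc n) + f 0 * (tail g ⋆ h) n + (tail f ⋆ (g ⋆ h)) n
      ≈⟨ +-congʳ (trans (+-congʳ (*-assoc _ _ _)) (sym (distribˡ _ _ _))) ⟩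
    f 0 * (g 0 * h (suc n) + (tail g ⋆ h) n) + (tail f ⋆ (g ⋆ h)) n
      ∎

  series-isCommutativeRing : IsCommutativeRing _≋_ _⊞_ _⋆_ ⊟_ 𝟘 𝟙
  series-isCommutativeRing = record
    { isRing = record
      { +-isAbelianGroup = record
        { isGroup = record
          { isMonoid = record
            { isSemigroup = record
              { isMagma = record
                { isEquivalence = record
                  { refl = λ n → refl ; sym = λ p n → sym (p n)
                  ; trans = λ p q n → trans (p n) (q n) }
                ; ∙-cong = λ p q n → +-cong (p n) (q n) }
              ; assoc = λ f g h n → +-assoc (f n) (g n) (h n) }
            ; identity = (λ f n → +-identityˡ (f n)) , (λ f n → +-identityʳ (f n)) }
          ; inverse = (λ f n → -‿inverseˡ (f n)) , (λ f n → -‿inverseʳ (f n))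
          ; ⁻¹-cong = λ p n → -‿cong (p n) }
        ; comm = λ f g n → +-comm (f n) (g n) }
      ; *-cong = ⋆-cong
      ; *-assoc = ⋆-assoc
      ; *-identity = ⋆-identityˡ , (λ f n → trans (⋆-comm f 𝟙 n) (⋆-identityˡ f n))
      ; distrib = (λ f g h n → trans (⋆-comm f (g ⊞ h) n) (trans (⋆-distribʳ g h f n)
                     (+-cong (⋆-comm g f n) (⋆-comm h f n))))
                , (λ h f g → ⋆-distribʳ f g h) }
    ; *-comm = ⋆-comm }

  seriesRing : CommutativeRing 0ℓ 0ℓ
  seriesRing = record { isCommutativeRing = series-isCommutativeRing }

  sumUpTo-apply : ∀ n (h : ℕ → Series) k → sumUpTo seriesRing n h k ≡ sumUpTo R n (λ i → h i k)
  sumUpTo-apply zero    h k = ≡.refl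
  sumUpTo-apply (suc n) h k = ≡.cong (_+ h (suc n) k) (sumUpTo-apply n h k)

  ⋆-as-sum : ∀ f g n → (f ⋆ g) n ≈ sumUpTo R n (λ i → f i * g (n ∸ i))
  ⋆-as-sum f g zero    = refl
  ⋆-as-sum f g (suc n) = trans (+-congˡ (⋆-as-sum (tail f) g n))
    (sym (sumUpTo-front R n (λ i → f i * g (suc n ∸ i))))

  <ᵇ-suc : ∀ d n → (d ℕ.<ᵇ suc n) ≡ (d ≤ᵇ n)
  <ᵇ-suc zero    n = ≡.refl
  <ᵇ-suc (suc d) n = ≡.refl

  monomial-⋆ : ∀ d x f n → (monomial d x ⋆ f) n ≈ (if d ≤ᵇ n then x * f (n ∸ d) else 0#)
  monomial-⋆ zero    x f zero    = refl
  monomial-⋆ zero    x f (suc n) = trans (+-congˡ (⋆-zeroˡ f n)) (+-identityʳ _)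
  monomial-⋆ (suc d) x f zero    = zeroˡ (f 0)
  monomial-⋆ (suc d) x f (suc n) rewrite <ᵇ-suc d n =
    trans (+-cong (zeroˡ _) (monomial-⋆ d x f n)) (+-identityˡ _)

  monomial-cong : ∀ d {x y} → x ≈ y → monomial d x ≋ monomial d y
  monomial-cong d p n with d ≡ᵇ n
  ... | true  = p
  ... | false = refl

  monomial₀-* : ∀ x y → monomial 0 (x * y) ≋ monomial 0 x ⋆ monomial 0 y
  monomial₀-* x y zero    = sym (monomial-⋆ 0 x (monomial 0 y) 0)
  monomial₀-* x y (suc n) = sym (trans (monomial-⋆ 0 x (monomial 0 y) (suc n)) (zeroʳ x))

  monomial₁-⋆ : ∀ u v → monomial u 1# ⋆ monomial v 1# ≋ monomial (u ℕ.+ v) 1#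
  monomial₁-⋆ zero    v n       = ⋆-identityˡ (monomial v 1#) n
  monomial₁-⋆ (suc u) v zero    = zeroˡ _
  monomial₁-⋆ (suc u) v (suc n) =
    trans (+-cong (zeroˡ _) (monomial₁-⋆ u v n)) (+-identityˡ _)

  module CoefficientMap (φ : Carrier → Carrier)
             (φ-+ : ∀ x y → φ (x + y) ≈ φ x + φ y)
             (φ-* : ∀ x y → φ (x * y) ≈ φ x * φ y) where
    coeffMap : Series → Series
    coeffMap f n = φ (f n)

    coeffMap-⋆ : ∀ f g → coeffMap (f ⋆ g) ≋ coeffMap f ⋆ coeffMap g
    coeffMap-⋆ f g zero    = φ-* _ _
    coeffMap-⋆ f g (suc n) = trans (φ-+ _ _) (+-cong (φ-* _ _) (coeffMap-⋆ (tail f) g n))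

  module Scale (w : ℕ → Carrier) (w-+ : ∀ m n → w (m ℕ.+ n) ≈ w m * w n) where
    scale : Series → Series
    scale f n = w n * f n

    scale-⋆ : ∀ f g → scale (f ⋆ g) ≋ scale f ⋆ scale g
    scale-⋆ f g zero    = trans (*-congʳ (w-+ 0 0)) (*-interchange _ _ _ _)
    scale-⋆ f g (suc n) = begin
      w (suc n) * (f 0 * g (suc n) + (tail f ⋆ g) n)
        ≈⟨ distribˡ _ _ _ ⟩
      w (suc n) * (f 0 * g (suc n)) + w (suc n) * (tail f ⋆ g) n
        ≈⟨ +-congˡ (trans (*-congʳ (w-+ 1 n)) (sym (x∙yz≈yx∙z _ _ _))) ⟩
      w (suc n) * (f 0 * g (suc n)) + w n * (w 1 * (tail f ⋆ g) n)
        ≈⟨ +-congˡ (*-congˡ (·-⋆-assoc (w 1) (tail f) g n)) ⟨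
      w (suc n) * (f 0 * g (suc n)) + w n * ((w 1 · tail f) ⋆ g) n
        ≈⟨ +-congˡ (scale-⋆ (w 1 · tail f) g n) ⟩
      w (suc n) * (f 0 * g (suc n)) + (scale (w 1 · tail f) ⋆ scale g) n
        ≈⟨ +-cong (trans (*-congʳ (w-+ 0 (suc n))) (*-interchange _ _ _ _))
                  (⋆-cong tail-scale (λ _ → refl) n) ⟩
      w 0 * f 0 * (w (suc n) * g (suc n)) + (tail (scale f) ⋆ scale g) n
        ∎
      where
      tail-scale : scale (w 1 · tail f) ≋ tail (scale f)
      tail-scale k = sym (trans (*-congʳ (w-+ 1 k)) (xy∙z≈y∙xz _ _ _))

open import Data.Bool using (_∧_)
open import Data.Bool.Properties using (∧-zeroʳ)
open import Data.Empty using (⊥-elim)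
open import Data.Integer as ℤ using (ℤ; 0ℤ; 1ℤ)
import Data.Integer.Properties as ℤ
open import Data.List using ([]; _∷_; map; _++_)
import Data.Nat.Properties as ℕ
open import Data.Sum using (_⊎_; inj₁; inj₂)
open import Data.Vec using (Vec; []; _∷_)
open import Relation.Binary.PropositionalEquality using (refl; sym; trans; cong; cong₂; subst)
open import Relation.Nullary using (¬_; yes; no)
open import Relation.Nullary.Reflects using (Reflects; ofʸ; ofⁿ; fromEquivalence; det)
open import Algebra.Properties.CommutativeSemigroup ℤ.+-commutativeSemigroup using ()
  renaming (interchange to ℤ-+-interchange)

open import Defs

-- ℤ[[s]], ℤ[[s]][[r]] and ℤ[[s]][[r]][[m]]; the carrier of the last is T, and ⊗ is its product.
module Zs   = PowerSeries ℤ.+-*-commutativeRing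
module Zrs  = PowerSeries Zs.seriesRing
module Zmrs = PowerSeries Zrs.seriesRing

sumTo-cong-≤ : ∀ n {f g : ℕ → ℤ} → (∀ i → i ≤ n → f i ≡ g i) → sumTo n f ≡ sumTo n g
sumTo-cong-≤ zero    p = p 0 ℕ.z≤n
sumTo-cong-≤ (suc n) p =
  cong₂ ℤ._+_ (sumTo-cong-≤ n (λ i i≤n → p i (ℕ.m≤n⇒m≤1+n i≤n))) (p (suc n) ℕ.≤-refl)

sumTo-cong : ∀ n {f g : ℕ → ℤ} → (∀ i → f i ≡ g i) → sumTo n f ≡ sumTo n g
sumTo-cong n p = sumTo-cong-≤ n (λ i _ → p i)

sumTo-zero : ∀ n {f : ℕ → ℤ} → (∀ i → i ≤ n → f i ≡ 0ℤ) → sumTo n f ≡ 0ℤ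
sumTo-zero zero    p = p 0 ℕ.z≤n
sumTo-zero (suc n) p =
  cong₂ ℤ._+_ (sumTo-zero n (λ i i≤n → p i (ℕ.m≤n⇒m≤1+n i≤n))) (p (suc n) ℕ.≤-refl)

sumTo-+ : ∀ n (f g : ℕ → ℤ) → sumTo n (λ i → f i ℤ.+ g i) ≡ sumTo n f ℤ.+ sumTo n g
sumTo-+ zero    f g = refl
sumTo-+ (suc n) f g = trans (cong (ℤ._+ (f (suc n) ℤ.+ g (suc n))) (sumTo-+ n f g))
  (ℤ-+-interchange (sumTo n f) (sumTo n g) (f (suc n)) (g (suc n)))

sumTo-comm : ∀ m n (f : ℕ → ℕ → ℤ) →
  sumTo m (λ i → sumTo n (λ j → f i j)) ≡ sumTo n (λ j → sumTo m (λ i → f i j))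
sumTo-comm zero    n f = refl
sumTo-comm (suc m) n f = trans (cong (ℤ._+ sumTo n (f (suc m))) (sumTo-comm m n f))
  (sym (sumTo-+ n (λ j → sumTo m (λ i → f i j)) (f (suc m))))

sumTo-front : ∀ n (f : ℕ → ℤ) → sumTo (suc n) f ≡ f 0 ℤ.+ sumTo n (λ i → f (suc i))
sumTo-front zero    f = refl
sumTo-front (suc n) f = trans (cong (ℤ._+ f (suc (suc n))) (sumTo-front n f)) (ℤ.+-assoc (f 0) _ _)

sumTo-head : ∀ n (f : ℕ → ℤ) → (∀ i → f (suc i) ≡ 0ℤ) → sumTo n f ≡ f 0
sumTo-head zero    f f-tail = refl
sumTo-head (suc n) f f-tail = trans (cong₂ ℤ._+_ (sumTo-head n f f-tail) (f-tail n)) (ℤ.+-identityʳ (f 0))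

sumUpTo-ℤ : ∀ n h → sumUpTo ℤ.+-*-commutativeRing n h ≡ sumTo n h
sumUpTo-ℤ zero    h = refl
sumUpTo-ℤ (suc n) h = cong (ℤ._+ h (suc n)) (sumUpTo-ℤ n h)

⋆ˢ-as-sumTo : ∀ p q c → (p Zs.⋆ q) c ≡ sumTo c (λ k → p k ℤ.* q (c ∸ k))
⋆ˢ-as-sumTo p q c = trans (Zs.⋆-as-sum p q c) (sumUpTo-ℤ c _)

⋆ʳˢ-as-sumTo : ∀ P Q b c →
  (P Zrs.⋆ Q) b c ≡ sumTo b (λ j → sumTo c (λ k → P j k ℤ.* Q (b ∸ j) (c ∸ k)))
⋆ʳˢ-as-sumTo P Q b c = begin
  (P Zrs.⋆ Q) b c                                     ≡⟨ Zrs.⋆-as-sum P Q b c ⟩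
  sumUpTo Zs.seriesRing b (λ j → P j Zs.⋆ Q (b ∸ j)) c ≡⟨ Zs.sumUpTo-apply b _ c ⟩
  sumUpTo _ b (λ j → (P j Zs.⋆ Q (b ∸ j)) c)          ≡⟨ sumUpTo-ℤ b _ ⟩
  sumTo b (λ j → (P j Zs.⋆ Q (b ∸ j)) c)
    ≡⟨ sumTo-cong b (λ j → ⋆ˢ-as-sumTo (P j) (Q (b ∸ j)) c) ⟩
  sumTo b (λ j → sumTo c (λ k → P j k ℤ.* Q (b ∸ j) (c ∸ k))) ∎
  where open ≡.≡-Reasoning

⊗-as-⋆ : ∀ F G → F ⊗ G ≈ F Zmrs.⋆ G
⊗-as-⋆ F G a b c = sym (begin
  (F Zmrs.⋆ G) a b c                                     ≡⟨ Zmrs.⋆-as-sum F G a b c ⟩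
  sumUpTo Zrs.seriesRing a (λ i → F i Zrs.⋆ G (a ∸ i)) b c
    ≡⟨ cong (λ f → f c) (Zrs.sumUpTo-apply a _ b) ⟩
  sumUpTo Zs.seriesRing a (λ i → (F i Zrs.⋆ G (a ∸ i)) b) c ≡⟨ Zs.sumUpTo-apply a _ c ⟩
  sumUpTo _ a (λ i → (F i Zrs.⋆ G (a ∸ i)) b c)          ≡⟨ sumUpTo-ℤ a _ ⟩
  sumTo a (λ i → (F i Zrs.⋆ G (a ∸ i)) b c)
    ≡⟨ sumTo-cong a (λ i → ⋆ʳˢ-as-sumTo (F i) (G (a ∸ i)) b c) ⟩
  (F ⊗ G) a b c ∎)
  where open ≡.≡-Reasoning

term : ℤ → ℕ → ℕ → ℕ → T
term u a b c a′ b′ c′ = if (a ≡ᵇ a′) ∧ ((b ≡ᵇ b′) ∧ (c ≡ᵇ c′)) then u else 0ℤ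

monomial³ : ℤ → ℕ → ℕ → ℕ → T
monomial³ u a b c = Zmrs.monomial a (Zrs.monomial b (Zs.monomial c u))

term≈monomial³ : ∀ u a b c → term u a b c ≈ monomial³ u a b c
term≈monomial³ u a b c a′ b′ c′ with a ≡ᵇ a′
... | false = refl
... | true with b ≡ᵇ b′
...   | false = refl
...   | true with c ≡ᵇ c′
...     | false = refl
...     | true  = refl

constant : ℤ → T
constant u = term u 0 0 0

𝕋 : CommutativeRing 0ℓ 0ℓ
𝕋 = record
  { Carrier = T ; _≈_ = _≈_ ; _+_ = _⊕_ ; _*_ = _⊗_ ; -_ = ⊖_ ; 0# = λ _ _ _ → 0ℤ ; 1# = one
  ; isCommutativeRing = isCommutativeRing-via Zmrs.seriesRing _⊗_ one ⊗-as-⋆ (term≈monomial³ 1ℤ 0 0 0)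
  }

module 𝕋 = CommutativeRing 𝕋

module ConstantMorphism where
  open import Algebra.Solver.Ring.AlmostCommutativeRing
  open import Data.Maybe using (Maybe; just; nothing)

  almostCommutativeRing : AlmostCommutativeRing 0ℓ 0ℓ
  almostCommutativeRing = fromCommutativeRing 𝕋

  constant-+ : ∀ x y → constant (x ℤ.+ y) ≈ constant x ⊕ constant y
  constant-+ x y a b c with (0 ≡ᵇ a) ∧ ((0 ≡ᵇ b) ∧ (0 ≡ᵇ c))
  ... | true  = refl
  ... | false = refl

  constant-neg : ∀ x → constant (ℤ.- x) ≈ ⊖ constant x
  constant-neg x a b c with (0 ≡ᵇ a) ∧ ((0 ≡ᵇ b) ∧ (0 ≡ᵇ c))
  ... | true  = refl
  ... | false = refl

  constant-0 : constant 0ℤ ≈ 𝕋.0#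
  constant-0 a b c with (0 ≡ᵇ a) ∧ ((0 ≡ᵇ b) ∧ (0 ≡ᵇ c))
  ... | true  = refl
  ... | false = refl

  constant-* : ∀ x y → constant (x ℤ.* y) ≈ constant x ⊗ constant y
  constant-* x y = 𝕋.trans (term≈monomial³ _ 0 0 0) (𝕋.trans monomial³-*
    (𝕋.sym (𝕋.trans (⊗-as-⋆ _ _) (Zmrs.⋆-cong (term≈monomial³ x 0 0 0) (term≈monomial³ y 0 0 0)))))
    where
    monomial³-* : monomial³ (x ℤ.* y) 0 0 0 ≈ monomial³ x 0 0 0 Zmrs.⋆ monomial³ y 0 0 0
    monomial³-* = 𝕋.trans
      (Zmrs.monomial-cong 0 λ b c → trans (Zrs.monomial-cong 0 (Zs.monomial₀-* x y) b c)
                                          (Zrs.monomial₀-* _ _ b c))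
      (Zmrs.monomial₀-* _ _)

  morphism : ℤ.+-*-rawRing -Raw-AlmostCommutative⟶ almostCommutativeRing
  morphism = record
    { ⟦_⟧ = constant ; +-homo = constant-+ ; *-homo = constant-* ; -‿homo = constant-neg
    ; 0-homo = constant-0 ; 1-homo = 𝕋.refl }

  _≟-constant_ : ∀ x y → Maybe (constant x ≈ constant y)
  x ≟-constant y with x ℤ.≟ y
  ... | yes refl = just 𝕋.refl
  ... | no _     = nothing

-- The ring solver on 𝕋 with integer coefficients; constant 1ℤ is one by definition, so that
-- con 1ℤ denotes one and fRS is the denotation of con 1ℤ :+ r :* (m :- con 1ℤ).
open ConstantMorphism using (almostCommutativeRing; morphism; _≟-constant_)
open import Algebra.Solver.Ring ℤ.+-*-rawRing almostCommutativeRing morphism _≟-constant_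
  using (solve; _:+_; _:*_; _:-_; :-_; _:=_; con)

module ≈-Reasoning = Relation.Binary.Reasoning.Setoid 𝕋.setoid

substR-cong : ∀ j {F G} → F ≈ G → substR j F ≈ substR j G
substR-cong j p a b c with j ℕ.* b ≤ᵇ c
... | true  = p a b _
... | false = refl

substR-⊕ : ∀ j F G → substR j (F ⊕ G) ≈ substR j F ⊕ substR j G
substR-⊕ j F G a b c with j ℕ.* b ≤ᵇ c
... | true  = refl
... | false = refl

substR-⊖ : ∀ j F → substR j (⊖ F) ≈ ⊖ substR j F
substR-⊖ j F a b c with j ℕ.* b ≤ᵇ c
... | true  = refl
... | false = refl

substR-0# : ∀ j → substR j 𝕋.0# ≈ 𝕋.0#
substR-0# j a b c with j ℕ.* b ≤ᵇ c
... | true  = refl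
... | false = refl

-- Coefficientwise in m, substR j multiplies the r^b-coefficient by s^(j b): a multiplicative weight.
module SubstRAsScaling (j : ℕ) where
  s^jb : ℕ → Zs.Series
  s^jb b = Zs.monomial (j ℕ.* b) 1ℤ

  s^jb-+ : ∀ m n → s^jb (m ℕ.+ n) Zs.≋ s^jb m Zs.⋆ s^jb n
  s^jb-+ m n k rewrite ℕ.*-distribˡ-+ j m n = sym (Zs.monomial₁-⋆ (j ℕ.* m) (j ℕ.* n) k)

  open Zrs.Scale s^jb s^jb-+

  open Zmrs.CoefficientMap scale
    (λ P Q b → CommutativeRing.distribˡ Zs.seriesRing (s^jb b) (P b) (Q b)) scale-⋆

  substR≈coeffMap : ∀ F → substR j F ≈ coeffMap F
  substR≈coeffMap F a b c with Zs.monomial-⋆ (j ℕ.* b) 1ℤ (F a b) c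
  ... | e with j ℕ.* b ≤ᵇ c
  ...   | true  = sym (trans e (ℤ.*-identityˡ _))
  ...   | false = sym e

  substR-⊗ : ∀ F G → substR j (F ⊗ G) ≈ substR j F ⊗ substR j G
  substR-⊗ F G = begin
    substR j (F ⊗ G)          ≈⟨ substR-cong j (⊗-as-⋆ F G) ⟩
    substR j (F Zmrs.⋆ G)     ≈⟨ substR≈coeffMap (F Zmrs.⋆ G) ⟩
    coeffMap (F Zmrs.⋆ G)     ≈⟨ coeffMap-⋆ F G ⟩
    coeffMap F Zmrs.⋆ coeffMap G ≈⟨ Zmrs.⋆-cong (substR≈coeffMap F) (substR≈coeffMap G) ⟨
    substR j F Zmrs.⋆ substR j G ≈⟨ ⊗-as-⋆ (substR j F) (substR j G) ⟨
    substR j F ⊗ substR j G   ∎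
    where open ≈-Reasoning

open SubstRAsScaling using (substR-⊗)

IndependentOfR : T → Set
IndependentOfR F = ∀ a b c → F a (suc b) c ≡ 0ℤ

substR-independent : ∀ j F → IndependentOfR F → substR j F ≈ F
substR-independent j F p a zero    c rewrite ℕ.*-zeroʳ j = refl
substR-independent j F p a (suc b) c with j ℕ.* suc b ≤ᵇ c
... | true  = trans (p a b _) (sym (p a b c))
... | false = sym (p a b c)

one-independent : IndependentOfR one
one-independent zero    b c = refl
one-independent (suc a) b c = refl

mV-independent : IndependentOfR mV
mV-independent zero          b c = refl
mV-independent (suc zero)    b c = refl
mV-independent (suc (suc a)) b c = refl

substR-^T-independent : ∀ j F k → IndependentOfR F → substR j (F ^T k) ≈ F ^T k
substR-^T-independent j F zero    p = substR-independent j one one-independent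
substR-^T-independent j F (suc k) p = begin
  substR j (F ⊗ F ^T k)        ≈⟨ substR-⊗ j F (F ^T k) ⟩
  substR j F ⊗ substR j (F ^T k) ≈⟨ 𝕋.*-cong (substR-independent j F p) (substR-^T-independent j F k p) ⟩
  F ⊗ F ^T k                   ∎
  where open ≈-Reasoning

-- Multiplication of a series in s by s^x; substR j F a b is shiftBy (j * b) (F a b).
shiftBy : ℕ → (ℕ → ℤ) → ℕ → ℤ
shiftBy x g c = if x ≤ᵇ c then g (c ∸ x) else 0ℤ

shiftBy-shiftBy : ∀ x y g c → shiftBy x (shiftBy y g) c ≡ shiftBy (y ℕ.+ x) g c
shiftBy-shiftBy x y g c
  with x ≤ᵇ c | ℕ.≤ᵇ-reflects-≤ x c | y ℕ.+ x ≤ᵇ c | ℕ.≤ᵇ-reflects-≤ (y ℕ.+ x) c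
... | false | _      | false | _      = refl
... | false | ofⁿ x≰c | true  | ofʸ y+x≤c = ⊥-elim (x≰c (ℕ.≤-trans (ℕ.m≤n+m x y) y+x≤c))
... | true  | ofʸ x≤c | _     | y+x≤c-reflects
  with y ≤ᵇ c ∸ x | ℕ.≤ᵇ-reflects-≤ y (c ∸ x) | y+x≤c-reflects
...   | true  | ofʸ y≤c-x  | ofʸ _      = cong g (trans (ℕ.∸-+-assoc c x y) (cong (c ∸_) (ℕ.+-comm x y)))
...   | true  | ofʸ y≤c-x  | ofⁿ y+x≰c  =
  ⊥-elim (y+x≰c (subst (y ℕ.+ x ≤_) (ℕ.m∸n+n≡m x≤c) (ℕ.+-monoˡ-≤ x y≤c-x)))
...   | false | ofⁿ y≰c-x  | ofʸ y+x≤c  =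
  ⊥-elim (y≰c-x (subst (_≤ c ∸ x) (ℕ.m+n∸n≡m y x) (ℕ.∸-monoˡ-≤ x y+x≤c)))
...   | false | ofⁿ _      | ofⁿ _      = refl

substR-substR : ∀ i j F → substR i (substR j F) ≈ substR (j ℕ.+ i) F
substR-substR i j F a b c rewrite ℕ.*-distribʳ-+ b j i = shiftBy-shiftBy (i ℕ.* b) (j ℕ.* b) (F a b) c

≡ᵇ-reflects-≡ : ∀ m n → Reflects (m ≡ n) (m ≡ᵇ n)
≡ᵇ-reflects-≡ m n = fromEquivalence (ℕ.≡ᵇ⇒≡ m n) (ℕ.≡⇒≡ᵇ m n)

≡ᵇ-∸ : ∀ {k z} c → k ≤ z → (c ≡ᵇ z ∸ k) ≡ (c ℕ.+ k ≡ᵇ z)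
≡ᵇ-∸ {k} {z} c k≤z = det (≡ᵇ-reflects-≡ c (z ∸ k)) (fromEquivalence
  (λ t → trans (sym (ℕ.m+n∸n≡m c k)) (cong (_∸ k) (ℕ.≡ᵇ⇒≡ _ _ t)))
  (λ e → ℕ.≡⇒≡ᵇ _ _ (trans (cong (ℕ._+ k) e) (ℕ.m∸n+n≡m k≤z))))

+-≡ᵇ-false : ∀ {k z} c → ¬ k ≤ z → (c ℕ.+ k ≡ᵇ z) ≡ false
+-≡ᵇ-false {k} {z} c k≰z =
  det (≡ᵇ-reflects-≡ (c ℕ.+ k) z) (ofⁿ (λ e → k≰z (subst (k ≤_) e (ℕ.m≤n+m k c))))

substR-mono : ∀ j a b c → substR j (mono a b c) ≈ mono a b (c ℕ.+ j ℕ.* b)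
substR-mono j a b c x y z with b ≡ᵇ y | ≡ᵇ-reflects-≡ b y
... | false | _ rewrite ∧-zeroʳ (a ≡ᵇ x) with j ℕ.* y ≤ᵇ z
...   | true  = refl
...   | false = refl
substR-mono j a b c x y z | true | ofʸ refl with j ℕ.* b ≤ᵇ z | ℕ.≤ᵇ-reflects-≤ (j ℕ.* b) z
... | true  | ofʸ p  rewrite ≡ᵇ-∸ c p = refl
... | false | ofⁿ ¬p rewrite +-≡ᵇ-false c ¬p | ∧-zeroʳ (a ≡ᵇ x) = refl

rs⊗-as-⋆ʳˢ : ∀ F a b c → (rs ⊗ F) a b c ≡ (Zrs.monomial 1 (Zs.monomial 1 1ℤ) Zrs.⋆ F a) b c
rs⊗-as-⋆ʳˢ F a b c = trans (⊗-as-⋆ rs F a b c)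
  (trans (Zmrs.⋆-cong (term≈monomial³ 1ℤ 0 1 1) (λ _ _ _ → refl) a b c) (Zmrs.monomial-⋆ 0 _ F a b c))

rs⊗-at-r⁰ : ∀ F a c → (rs ⊗ F) a 0 c ≡ 0ℤ
rs⊗-at-r⁰ F a c = trans (rs⊗-as-⋆ʳˢ F a 0 c) (Zrs.monomial-⋆ 1 (Zs.monomial 1 1ℤ) (F a) 0 c)

rs⊗-at-s⁰ : ∀ F a b → (rs ⊗ F) a b 0 ≡ 0ℤ
rs⊗-at-s⁰ F a zero    = rs⊗-at-r⁰ F a 0
rs⊗-at-s⁰ F a (suc b) = trans (rs⊗-as-⋆ʳˢ F a (suc b) 0)
  (trans (Zrs.monomial-⋆ 1 (Zs.monomial 1 1ℤ) (F a) (suc b) 0) (Zs.monomial-⋆ 1 1ℤ (F a b) 0))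

rs⊗-at-suc : ∀ F a b c → (rs ⊗ F) a (suc b) (suc c) ≡ F a b c
rs⊗-at-suc F a b c = trans (rs⊗-as-⋆ʳˢ F a (suc b) (suc c))
  (trans (Zrs.monomial-⋆ 1 (Zs.monomial 1 1ℤ) (F a) (suc b) (suc c))
    (trans (Zs.monomial-⋆ 1 1ℤ (F a b) (suc c)) (ℤ.*-identityˡ _)))

mono-suc : ∀ b c → mono 0 (suc b) (suc c) ≈ rs ⊗ mono 0 b c
mono-suc b c x zero    z       rewrite ∧-zeroʳ (0 ≡ᵇ x) = sym (rs⊗-at-r⁰ (mono 0 b c) x z)
mono-suc b c x (suc y) zero    rewrite ∧-zeroʳ (b ≡ᵇ y) | ∧-zeroʳ (0 ≡ᵇ x) =
  sym (rs⊗-at-s⁰ (mono 0 b c) x (suc y))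
mono-suc b c x (suc y) (suc z) = sym (rs⊗-at-suc (mono 0 b c) x y z)

-- The factor contributed by an element of S: m if it starts a run, m - 1 if it continues one.
runFactor : Bool → T
runFactor false = mV
runFactor true  = mV ⊝ one

runFactor-independent : ∀ p → IndependentOfR (runFactor p)
runFactor-independent false = mV-independent
runFactor-independent true a b c rewrite mV-independent a b c =
  trans (ℤ.+-identityˡ _) (cong ℤ.-_ (one-independent a b c))

weightFrom : ∀ {n} → Bool → Vec Bool n → T
weightFrom p S =
  mono 0 (size S) (sigma S) ⊗ mV ^T runsFrom p S ⊗ runFactor true ^T (size S ∸ runsFrom p S)

-- GFrom true n is G n computed as if 0 belonged to S, so that a run starting at 1 is not new.
GFrom : Bool → ℕ → T
GFrom p n = sumT (map (weightFrom p) (allSubsets n))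

sigmaFrom-suc : ∀ {n} off (v : Vec Bool n) → sigmaFrom (suc off) v ≡ sigmaFrom off v ℕ.+ size v
sigmaFrom-suc off []          = refl
sigmaFrom-suc off (false ∷ v) = sigmaFrom-suc (suc off) v
sigmaFrom-suc off (true ∷ v)  = begin
  suc off ℕ.+ sigmaFrom (suc (suc off)) v       ≡⟨ cong (suc off ℕ.+_) (sigmaFrom-suc (suc off) v) ⟩
  suc off ℕ.+ (sigmaFrom (suc off) v ℕ.+ size v) ≡⟨ cong suc (ℕ.+-assoc off _ (size v)) ⟨
  suc (off ℕ.+ sigmaFrom (suc off) v ℕ.+ size v) ≡⟨ ℕ.+-suc _ (size v) ⟨
  off ℕ.+ sigmaFrom (suc off) v ℕ.+ suc (size v) ∎
  where open ≡.≡-Reasoning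

runsFrom≤size : ∀ {n} p (v : Vec Bool n) → runsFrom p v ≤ size v
runsFrom≤size p     []          = ℕ.z≤n
runsFrom≤size true  (true ∷ v)  = ℕ.m≤n⇒m≤1+n (runsFrom≤size true v)
runsFrom≤size false (true ∷ v)  = ℕ.s≤s (runsFrom≤size true v)
runsFrom≤size true  (false ∷ v) = runsFrom≤size false v
runsFrom≤size false (false ∷ v) = runsFrom≤size false v

substR₁-weightFrom : ∀ {n} p (v : Vec Bool n) → substR 1 (weightFrom p v) ≈
  mono 0 (size v) (sigmaFrom 2 v) ⊗ mV ^T runsFrom p v ⊗ runFactor true ^T (size v ∸ runsFrom p v)
substR₁-weightFrom p v = begin
  substR 1 (M ⊗ A ⊗ B)             ≈⟨ substR-⊗ 1 (M ⊗ A) B ⟩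
  substR 1 (M ⊗ A) ⊗ substR 1 B
    ≈⟨ 𝕋.*-cong (substR-⊗ 1 M A) (substR-^T-independent 1 (runFactor true) k (runFactor-independent true)) ⟩
  substR 1 M ⊗ substR 1 A ⊗ B
    ≈⟨ 𝕋.*-congʳ {B} (𝕋.*-cong (substR-mono 1 0 (size v) (sigma v))
                                (substR-^T-independent 1 mV (runsFrom p v) mV-independent)) ⟩
  mono 0 (size v) (sigma v ℕ.+ 1 ℕ.* size v) ⊗ A ⊗ B
    ≡⟨ cong (λ σ → mono 0 (size v) σ ⊗ A ⊗ B)
            (trans (cong (sigma v ℕ.+_) (ℕ.*-identityˡ (size v))) (sym (sigmaFrom-suc 1 v))) ⟩
  mono 0 (size v) (sigmaFrom 2 v) ⊗ A ⊗ B ∎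
  where
  open ≈-Reasoning
  M = mono 0 (size v) (sigma v)
  A = mV ^T runsFrom p v
  k = size v ∸ runsFrom p v
  B = runFactor true ^T k

weightFrom-false∷ : ∀ {n} p (v : Vec Bool n) → weightFrom p (false ∷ v) ≈ substR 1 (weightFrom false v)
weightFrom-false∷ false v = 𝕋.sym (substR₁-weightFrom false v)
weightFrom-false∷ true  v = 𝕋.sym (substR₁-weightFrom false v)

weightFrom-true∷ : ∀ {n} p (v : Vec Bool n) →
  weightFrom p (true ∷ v) ≈ rs ⊗ (runFactor p ⊗ substR 1 (weightFrom true v))
weightFrom-true∷ false v = begin
  mono 0 (suc s) (suc σ) ⊗ (mV ⊗ A) ⊗ B ≈⟨ 𝕋.*-congʳ {B} (𝕋.*-congʳ {mV ⊗ A} (mono-suc s σ)) ⟩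
  rs ⊗ M ⊗ (mV ⊗ A) ⊗ B
    ≈⟨ solve 5 (λ r c M A B → r :* M :* (c :* A) :* B := r :* (c :* (M :* A :* B))) 𝕋.refl rs mV M A B ⟩
  rs ⊗ (mV ⊗ (M ⊗ A ⊗ B))
    ≈⟨ 𝕋.*-congˡ {rs} (𝕋.*-congˡ {mV} (substR₁-weightFrom true v)) ⟨
  rs ⊗ (mV ⊗ substR 1 (weightFrom true v)) ∎
  where
  open ≈-Reasoning
  s = size v
  σ = sigmaFrom 2 v
  M = mono 0 s σ
  A = mV ^T runsFrom true v
  B = runFactor true ^T (s ∸ runsFrom true v)
weightFrom-true∷ true v rewrite ℕ.+-∸-assoc 1 (runsFrom≤size true v) = begin
  mono 0 (suc s) (suc σ) ⊗ A ⊗ (D ⊗ B) ≈⟨ 𝕋.*-congʳ {D ⊗ B} (𝕋.*-congʳ {A} (mono-suc s σ)) ⟩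
  rs ⊗ M ⊗ A ⊗ (D ⊗ B)
    ≈⟨ solve 5 (λ r c M A B → r :* M :* A :* (c :* B) := r :* (c :* (M :* A :* B))) 𝕋.refl rs D M A B ⟩
  rs ⊗ (D ⊗ (M ⊗ A ⊗ B))
    ≈⟨ 𝕋.*-congˡ {rs} (𝕋.*-congˡ {D} (substR₁-weightFrom true v)) ⟨
  rs ⊗ (D ⊗ substR 1 (weightFrom true v)) ∎
  where
  open ≈-Reasoning
  s = size v
  σ = sigmaFrom 2 v
  D = runFactor true
  M = mono 0 s σ
  A = mV ^T runsFrom true v
  B = D ^T (s ∸ runsFrom true v)

sumT-map-++ : ∀ {A : Set} (f : A → T) xs ys → sumT (map f (xs ++ ys)) ≈ sumT (map f xs) ⊕ sumT (map f ys)
sumT-map-++ f []       ys = 𝕋.sym (𝕋.+-identityˡ _)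
sumT-map-++ f (x ∷ xs) ys = 𝕋.trans (𝕋.+-congˡ {f x} (sumT-map-++ f xs ys))
  (𝕋.sym (𝕋.+-assoc (f x) (sumT (map f xs)) (sumT (map f ys))))

sumT-map-map : ∀ {A B : Set} {f : B → T} {g : A → B} {h : A → T} → (∀ x → f (g x) ≈ h x) →
  ∀ xs → sumT (map f (map g xs)) ≈ sumT (map h xs)
sumT-map-map e []       = 𝕋.refl
sumT-map-map e (x ∷ xs) = 𝕋.+-cong (e x) (sumT-map-map e xs)

sumT-map-substR : ∀ {A : Set} j (f : A → T) xs →
  sumT (map (λ x → substR j (f x)) xs) ≈ substR j (sumT (map f xs))
sumT-map-substR j f []       = 𝕋.sym (substR-0# j)
sumT-map-substR j f (x ∷ xs) =
  𝕋.trans (𝕋.+-congˡ {substR j (f x)} (sumT-map-substR j f xs))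
          (𝕋.sym (substR-⊕ j (f x) (sumT (map f xs))))

sumT-map-⊗ˡ : ∀ {A : Set} F (f : A → T) xs → sumT (map (λ x → F ⊗ f x) xs) ≈ F ⊗ sumT (map f xs)
sumT-map-⊗ˡ F f []       = 𝕋.sym (𝕋.zeroʳ F)
sumT-map-⊗ˡ F f (x ∷ xs) =
  𝕋.trans (𝕋.+-congˡ {F ⊗ f x} (sumT-map-⊗ˡ F f xs)) (𝕋.sym (𝕋.distribˡ F (f x) (sumT (map f xs))))

GFrom-suc : ∀ p n → GFrom p (suc n) ≈ substR 1 (G n) ⊕ rs ⊗ (runFactor p ⊗ substR 1 (GFrom true n))
GFrom-suc p n = begin
  sumT (map (weightFrom p) (map (false ∷_) S ++ map (true ∷_) S))
    ≈⟨ sumT-map-++ (weightFrom p) (map (false ∷_) S) (map (true ∷_) S) ⟩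
  sumT (map (weightFrom p) (map (false ∷_) S)) ⊕ sumT (map (weightFrom p) (map (true ∷_) S))
    ≈⟨ 𝕋.+-cong (sumT-map-map (weightFrom-false∷ p) S) (sumT-map-map (weightFrom-true∷ p) S) ⟩
  sumT (map (λ v → substR 1 (weightFrom false v)) S)
    ⊕ sumT (map (λ v → rs ⊗ (runFactor p ⊗ substR 1 (weightFrom true v))) S)
    ≈⟨ 𝕋.+-cong (sumT-map-substR 1 (weightFrom false) S) (begin
         sumT (map (λ v → rs ⊗ (runFactor p ⊗ substR 1 (weightFrom true v))) S)
           ≈⟨ sumT-map-⊗ˡ rs _ S ⟩
         rs ⊗ sumT (map (λ v → runFactor p ⊗ substR 1 (weightFrom true v)) S)
           ≈⟨ 𝕋.*-congˡ {rs} (sumT-map-⊗ˡ (runFactor p) _ S) ⟩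
         rs ⊗ (runFactor p ⊗ sumT (map (λ v → substR 1 (weightFrom true v)) S))
           ≈⟨ 𝕋.*-congˡ {rs} (𝕋.*-congˡ {runFactor p} (sumT-map-substR 1 (weightFrom true) S)) ⟩
         rs ⊗ (runFactor p ⊗ substR 1 (GFrom true n)) ∎) ⟩
  substR 1 (G n) ⊕ rs ⊗ (runFactor p ⊗ substR 1 (GFrom true n)) ∎
  where
  open ≈-Reasoning
  S = allSubsets n

G-zero : G 0 ≈ one
G-zero = 𝕋.trans (𝕋.+-identityʳ _) (𝕋.trans (𝕋.*-identityʳ _) (𝕋.*-identityʳ one))

one-at-s⁰ : ∀ a b → one a b 0 ≡ 1P a b
one-at-s⁰ zero    zero    = refl
one-at-s⁰ zero    (suc b) = refl
one-at-s⁰ (suc a) b       = refl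

G-at-s⁰ : ∀ n a b → G n a b 0 ≡ 1P a b
G-at-s⁰ zero    a b = trans (G-zero a b 0) (one-at-s⁰ a b)
G-at-s⁰ (suc n) a b = trans (GFrom-suc false n a b 0)
  (trans (cong₂ ℤ._+_ (substR₁-at-s⁰ a b) (rs⊗-at-s⁰ (runFactor false ⊗ substR 1 (GFrom true n)) a b))
         (ℤ.+-identityʳ (1P a b)))
  where
  substR₁-at-s⁰ : ∀ a b → substR 1 (G n) a b 0 ≡ 1P a b
  substR₁-at-s⁰ a       zero    = G-at-s⁰ n a 0
  substR₁-at-s⁰ zero    (suc b) = refl
  substR₁-at-s⁰ (suc a) (suc b) = refl

G-recurrence : ∀ n → G (suc (suc n)) ≈ fRS ⊗ substR 1 (G (suc n)) ⊕ rs ⊗ substR 1 (substR 1 (G n))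
G-recurrence n = begin
  G (suc (suc n))
    ≈⟨ GFrom-suc false (suc n) ⟩
  substR 1 (G (suc n)) ⊕ rs ⊗ (mV ⊗ substR 1 (GFrom true (suc n)))
    ≈⟨ 𝕋.+-cong (shifted false) (𝕋.*-congˡ {rs} (𝕋.*-congˡ {mV} (shifted true))) ⟩
  (SU ⊕ q ⊗ (mV ⊗ SV)) ⊕ rs ⊗ (mV ⊗ (SU ⊕ q ⊗ ((mV ⊝ one) ⊗ SV)))
    ≈⟨ solve 5 (λ SU SV q r m →
         (SU :+ q :* (m :* SV)) :+ r :* (m :* (SU :+ q :* ((m :- con 1ℤ) :* SV)))
           := (con 1ℤ :+ r :* (m :- con 1ℤ)) :* (SU :+ q :* (m :* SV)) :+ r :* SU)
         𝕋.refl SU SV q rs mV ⟩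
  fRS ⊗ (SU ⊕ q ⊗ (mV ⊗ SV)) ⊕ rs ⊗ SU
    ≈⟨ 𝕋.+-congʳ {rs ⊗ SU} (𝕋.*-congˡ {fRS} (shifted false)) ⟨
  fRS ⊗ substR 1 (G (suc n)) ⊕ rs ⊗ SU ∎
  where
  open ≈-Reasoning
  SU = substR 1 (substR 1 (G n))
  SV = substR 1 (substR 1 (GFrom true n))
  q  = substR 1 rs
  shifted : ∀ p → substR 1 (GFrom p (suc n)) ≈ SU ⊕ q ⊗ (runFactor p ⊗ SV)
  shifted p = begin
    substR 1 (GFrom p (suc n))
      ≈⟨ substR-cong 1 (GFrom-suc p n) ⟩
    substR 1 (substR 1 (G n) ⊕ rs ⊗ (runFactor p ⊗ substR 1 (GFrom true n)))
      ≈⟨ substR-⊕ 1 (substR 1 (G n)) (rs ⊗ X) ⟩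
    SU ⊕ substR 1 (rs ⊗ X)
      ≈⟨ 𝕋.+-congˡ {SU} (𝕋.trans (substR-⊗ 1 rs X)
           (𝕋.*-congˡ {q} (substR-⊗ 1 (runFactor p) (substR 1 (GFrom true n))))) ⟩
    SU ⊕ q ⊗ (substR 1 (runFactor p) ⊗ SV)
      ≈⟨ 𝕋.+-congˡ {SU} (𝕋.*-congˡ {q} (𝕋.*-congʳ {SV}
           (substR-independent 1 (runFactor p) (runFactor-independent p)))) ⟩
    SU ⊕ q ⊗ (runFactor p ⊗ SV) ∎
    where X = runFactor p ⊗ substR 1 (GFrom true n)

1P-⊗P : ∀ q a b → (1P ⊗P q) a b ≡ q a b
1P-⊗P q a b = trans
  (sumTo-head a (λ i → sumTo b (λ j → 1P i j ℤ.* q (a ∸ i) (b ∸ j)))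
    (λ i → sumTo-zero b (λ j _ → ℤ.*-zeroˡ (q (a ∸ suc i) (b ∸ j)))))
  (trans (sumTo-head b (λ j → 1P 0 j ℤ.* q a (b ∸ j)) (λ j → ℤ.*-zeroˡ (q a (b ∸ suc j))))
         (ℤ.*-identityˡ (q a b)))

module Inverse (F : T) (F-at-s⁰ : ∀ a b → F a b 0 ≡ 1P a b) where
  inv : ℕ → P
  inv k = headP (invUpTo F k)

  F₀-⊗P : ∀ q a b → (sCoeff F 0 ⊗P q) a b ≡ q a b
  F₀-⊗P q a b = trans
    (sumTo-cong a λ i → sumTo-cong b λ j → cong (ℤ._* q (a ∸ i) (b ∸ j)) (F-at-s⁰ i j))
    (1P-⊗P q a b)

  convStep-as-sumTo : ∀ k t a b →
    convStep F t (invUpTo F k) a b ≡ sumTo k (λ i → (sCoeff F (suc (t ℕ.+ i)) ⊗P inv (k ∸ i)) a b)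
  convStep-as-sumTo zero    t a b rewrite ℕ.+-identityʳ t = ℤ.+-identityʳ _
  convStep-as-sumTo (suc k) t a b = begin
    (sCoeff F (suc t) ⊗P inv (suc k)) a b ℤ.+ convStep F (suc t) (invUpTo F k) a b
      ≡⟨ cong₂ ℤ._+_ (cong (λ u → (sCoeff F (suc u) ⊗P inv (suc k)) a b) (sym (ℕ.+-identityʳ t)))
           (trans (convStep-as-sumTo k (suc t) a b)
                  (sumTo-cong k λ i → cong (λ u → (sCoeff F (suc u) ⊗P inv (k ∸ i)) a b)
                                           (sym (ℕ.+-suc t i)))) ⟩
    (sCoeff F (suc (t ℕ.+ 0)) ⊗P inv (suc k)) a b
      ℤ.+ sumTo k (λ i → (sCoeff F (suc (t ℕ.+ suc i)) ⊗P inv (k ∸ i)) a b)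
      ≡⟨ sumTo-front k (λ i → (sCoeff F (suc (t ℕ.+ i)) ⊗P inv (suc k ∸ i)) a b) ⟨
    sumTo (suc k) (λ i → (sCoeff F (suc (t ℕ.+ i)) ⊗P inv (suc k ∸ i)) a b) ∎
    where open ≡.≡-Reasoning

  ⊗-by-s-degree : ∀ a b c → (F ⊗ invS F) a b c ≡ sumTo c (λ z → (sCoeff F z ⊗P inv (c ∸ z)) a b)
  ⊗-by-s-degree a b c =
    trans (sumTo-cong a λ i → sumTo-comm b c (λ j z → F i j z ℤ.* invS F (a ∸ i) (b ∸ j) (c ∸ z)))
          (sumTo-comm a c (λ i z → sumTo b (λ j → F i j z ℤ.* invS F (a ∸ i) (b ∸ j) (c ∸ z))))

  invS-inverse : F ⊗ invS F ≈ one
  invS-inverse a b zero    = trans (⊗-by-s-degree a b 0) (trans (F₀-⊗P 1P a b) (sym (one-at-s⁰ a b)))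
  invS-inverse a b (suc c) = begin
    (F ⊗ invS F) a b (suc c)
      ≡⟨ ⊗-by-s-degree a b (suc c) ⟩
    sumTo (suc c) (λ z → (sCoeff F z ⊗P inv (suc c ∸ z)) a b)
      ≡⟨ sumTo-front c _ ⟩
    (sCoeff F 0 ⊗P inv (suc c)) a b ℤ.+ sumTo c (λ z → (sCoeff F (suc z) ⊗P inv (c ∸ z)) a b)
      ≡⟨ cong₂ ℤ._+_ (F₀-⊗P (inv (suc c)) a b) (sym (convStep-as-sumTo c 0 a b)) ⟩
    ℤ.- convStep F 0 (invUpTo F c) a b ℤ.+ convStep F 0 (invUpTo F c) a b
      ≡⟨ ℤ.+-inverseˡ (convStep F 0 (invUpTo F c) a b) ⟩
    0ℤ
      ≡⟨ one-at-s-suc a b ⟨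
    one a b (suc c) ∎
    where
    open ≡.≡-Reasoning
    one-at-s-suc : ∀ a b → one a b (suc c) ≡ 0ℤ
    one-at-s-suc zero    zero    = refl
    one-at-s-suc zero    (suc b) = refl
    one-at-s-suc (suc a) b       = refl

OrderAtLeast : ℕ → T → Set
OrderAtLeast v F = ∀ a b c → c ℕ.< v ⊎ b ≡ 0 → F a b c ≡ 0ℤ

order-⊖ : ∀ {v F} → OrderAtLeast v F → OrderAtLeast v (⊖ F)
order-⊖ F-ord a b c h = cong ℤ.-_ (F-ord a b c h)

order-weaken : ∀ {v F} → OrderAtLeast (suc v) F → OrderAtLeast v F
order-weaken F-ord a b c (inj₁ c<v) = F-ord a b c (inj₁ (ℕ.m<n⇒m<1+n c<v))
order-weaken F-ord a b c (inj₂ b≡0) = F-ord a b c (inj₂ b≡0)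

order-rs⊗ : ∀ F → OrderAtLeast 1 (rs ⊗ F)
order-rs⊗ F a b       zero    h                    = rs⊗-at-s⁰ F a b
order-rs⊗ F a zero    (suc c) h                    = rs⊗-at-r⁰ F a (suc c)
order-rs⊗ F a (suc b) (suc c) (inj₁ (ℕ.s≤s ()))

order-rs⊗-suc : ∀ {v} F → OrderAtLeast v F → OrderAtLeast (suc v) (rs ⊗ F)
order-rs⊗-suc F F-ord a b       zero    h                   = rs⊗-at-s⁰ F a b
order-rs⊗-suc F F-ord a zero    (suc c) h                   = rs⊗-at-r⁰ F a (suc c)
order-rs⊗-suc F F-ord a (suc b) (suc c) (inj₁ (ℕ.s≤s c<v)) =
  trans (rs⊗-at-suc F a b c) (F-ord a b c (inj₁ c<v))

-- substR 1 moves the coefficient of r^b s^c to r^b s^(c+b), and b ≥ 1 on a multiple of r.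
order-substR₁ : ∀ {v} F → OrderAtLeast v F → OrderAtLeast (suc v) (substR 1 F)
order-substR₁ F F-ord a zero    c h        = F-ord a 0 c (inj₂ refl)
order-substR₁ {v} F F-ord a (suc b) c (inj₁ c<1+v)
  with 1 ℕ.* suc b ≤ᵇ c | ℕ.≤ᵇ-reflects-≤ (1 ℕ.* suc b) c
... | false | _      = refl
... | true  | ofʸ b<c = F-ord a (suc b) _ (inj₁ (∸-suc-< b<c c<1+v))
  where
  ∸-suc-< : ∀ {k c} → suc k ≤ c → c ℕ.< suc v → c ∸ suc k ℕ.< v
  ∸-suc-< {k} {suc c} _ (ℕ.s≤s c<v) = ℕ.≤-trans (ℕ.s≤s (ℕ.m∸n≤m c k)) c<v

⊗-vanishes : ∀ F G a b c → (∀ a′ b′ c′ → b′ ≤ b → c′ ≤ c → G a′ b′ c′ ≡ 0ℤ) →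
  (F ⊗ G) a b c ≡ 0ℤ
⊗-vanishes F G a b c G-zero =
  sumTo-zero a λ a₁ _ → sumTo-zero b λ b₁ _ → sumTo-zero c λ c₁ _ →
    trans (cong (F a₁ b₁ c₁ ℤ.*_) (G-zero _ _ _ (ℕ.m∸n≤m b b₁) (ℕ.m∸n≤m c c₁)))
          (ℤ.*-zeroʳ (F a₁ b₁ c₁))

-- The r-degree of the correction term rs ⊗ (W ⊗ Y) exceeds that of Y, so Y inherits the order of Z
-- by induction on the r-degree.
order-of-resolvent : ∀ {v} W Y Z → Y ⊕ rs ⊗ (W ⊗ Y) ≈ Z → OrderAtLeast v Z → OrderAtLeast v Y
order-of-resolvent {v} W Y Z eq Z-ord a b c = bounded b b ℕ.≤-refl a c
  where
  via-Z : ∀ {a b c} → (rs ⊗ (W ⊗ Y)) a b c ≡ 0ℤ → c ℕ.< v ⊎ b ≡ 0 → Y a b c ≡ 0ℤ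
  via-Z {a} {b} {c} k h = trans (sym (ℤ.+-identityʳ _))
    (trans (cong (λ t → Y a b c ℤ.+ t) (sym k)) (trans (eq a b c) (Z-ord a b c h)))
  bounded : ∀ B b → b ≤ B → ∀ a c → c ℕ.< v ⊎ b ≡ 0 → Y a b c ≡ 0ℤ
  bounded B       zero    _           a c       h          = via-Z (rs⊗-at-r⁰ (W ⊗ Y) a c) h
  bounded B       (suc b) _           a zero    h          = via-Z (rs⊗-at-s⁰ (W ⊗ Y) a (suc b)) h
  bounded (suc B) (suc b) (ℕ.s≤s b≤B) a (suc c) (inj₁ c<v) =
    via-Z (trans (rs⊗-at-suc (W ⊗ Y) a b c) (⊗-vanishes W Y a b c λ a′ b′ c′ b′≤b c′≤c →
             bounded B b′ (ℕ.≤-trans b′≤b b≤B) a′ c′ (inj₁ (ℕ.≤-trans (ℕ.s≤s c′≤c) (ℕ.<⇒≤ c<v)))))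
          (inj₁ c<v)

infix 4 _≈[s≤_]_
_≈[s≤_]_ : T → ℕ → T → Set
F ≈[s≤ k ] G = ∀ a b c → c ≤ k → F a b c ≡ G a b c

≈⇒≈[s≤] : ∀ {k F G} → F ≈ G → F ≈[s≤ k ] G
≈⇒≈[s≤] F≈G a b c _ = F≈G a b c

≈[s≤]-setoid : ℕ → Setoid 0ℓ 0ℓ
≈[s≤]-setoid k = record
  { Carrier = T
  ; _≈_ = _≈[s≤ k ]_
  ; isEquivalence = record
    { refl  = λ _ _ _ _ → refl
    ; sym   = λ F≈G a b c c≤k → sym (F≈G a b c c≤k)
    ; trans = λ F≈G G≈H a b c c≤k → trans (F≈G a b c c≤k) (G≈H a b c c≤k)
    }
  }

⊗-cong-≈[s≤] : ∀ {k} F F′ G G′ → F ≈[s≤ k ] F′ → G ≈[s≤ k ] G′ → F ⊗ G ≈[s≤ k ] F′ ⊗ G′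
⊗-cong-≈[s≤] F F′ G G′ F≈F′ G≈G′ a b c c≤k =
  sumTo-cong a λ a₁ → sumTo-cong b λ b₁ → sumTo-cong-≤ c λ c₁ c₁≤c →
    cong₂ ℤ._*_ (F≈F′ a₁ b₁ c₁ (ℕ.≤-trans c₁≤c c≤k))
                (G≈G′ (a ∸ a₁) (b ∸ b₁) (c ∸ c₁) (ℕ.≤-trans (ℕ.m∸n≤m c c₁) c≤k))

substR-cong-≈[s≤] : ∀ {k} j F G → F ≈[s≤ k ] G → substR j F ≈[s≤ k ] substR j G
substR-cong-≈[s≤] j F G F≈G a b c c≤k with j ℕ.* b ≤ᵇ c
... | true  = F≈G a b (c ∸ j ℕ.* b) (ℕ.≤-trans (ℕ.m∸n≤m c (j ℕ.* b)) c≤k)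
... | false = refl

module FunctionalEquation (χ : T) (isChi : IsChi χ) where
  W : T
  W = (mV ⊝ one) ⊕ substR 1 χ

  chi-inverts : (one ⊕ rs ⊗ W) ⊗ χ ≈ one
  chi-inverts = begin
    (one ⊕ rs ⊗ W) ⊗ χ
      ≈⟨ solve 4 (λ c Sc r m → (con 1ℤ :+ r :* ((m :- con 1ℤ) :+ Sc)) :* c
                                  := (con 1ℤ :+ r :* (m :- con 1ℤ)) :* c :+ r :* Sc :* c)
                 𝕋.refl χ (substR 1 χ) rs mV ⟩
    fRS ⊗ χ ⊕ rs ⊗ substR 1 χ ⊗ χ
      ≈⟨ 𝕋.+-congʳ {rs ⊗ substR 1 χ ⊗ χ} isChi ⟩
    one ⊝ rs ⊗ substR 1 χ ⊗ χ ⊕ rs ⊗ substR 1 χ ⊗ χ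
      ≈⟨ solve 1 (λ x → con 1ℤ :- x :+ x := con 1ℤ) 𝕋.refl (rs ⊗ substR 1 χ ⊗ χ) ⟩
    one ∎
    where open ≈-Reasoning

  defect : ℕ → T
  defect n = χ ⊗ G (suc n) ⊝ substR 1 (G n)

  defect-recurrence : ∀ n → defect (suc n) ⊕ rs ⊗ (W ⊗ defect (suc n)) ≈ ⊖ (rs ⊗ substR 1 (defect n))
  defect-recurrence n = begin
    defect (suc n) ⊕ rs ⊗ (W ⊗ defect (suc n))
      ≈⟨ solve 6 (λ c G₂ SG₁ Sc r m →
           (c :* G₂ :- SG₁) :+ r :* (((m :- con 1ℤ) :+ Sc) :* (c :* G₂ :- SG₁))
             := (con 1ℤ :+ r :* ((m :- con 1ℤ) :+ Sc)) :* c :* G₂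
                :- (con 1ℤ :+ r :* (m :- con 1ℤ)) :* SG₁ :- r :* (Sc :* SG₁))
           𝕋.refl χ G₂ SG₁ Sχ rs mV ⟩
    (one ⊕ rs ⊗ W) ⊗ χ ⊗ G₂ ⊝ fRS ⊗ SG₁ ⊝ rs ⊗ (Sχ ⊗ SG₁)
      ≈⟨ 𝕋.+-congʳ {⊖ (rs ⊗ (Sχ ⊗ SG₁))} (𝕋.+-congʳ {⊖ (fRS ⊗ SG₁)}
           (𝕋.*-cong chi-inverts (G-recurrence n))) ⟩
    one ⊗ (fRS ⊗ SG₁ ⊕ rs ⊗ SSG) ⊝ fRS ⊗ SG₁ ⊝ rs ⊗ (Sχ ⊗ SG₁)
      ≈⟨ solve 5 (λ SG₁ SSG Sc r m →
           con 1ℤ :* ((con 1ℤ :+ r :* (m :- con 1ℤ)) :* SG₁ :+ r :* SSG)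
             :- (con 1ℤ :+ r :* (m :- con 1ℤ)) :* SG₁ :- r :* (Sc :* SG₁)
             := :- (r :* (Sc :* SG₁ :- SSG)))
           𝕋.refl SG₁ SSG Sχ rs mV ⟩
    ⊖ (rs ⊗ (Sχ ⊗ SG₁ ⊝ SSG))
      ≈⟨ 𝕋.-‿cong (𝕋.*-congˡ {rs}
           (𝕋.+-cong (substR-⊗ 1 χ (G (suc n))) (substR-⊖ 1 (substR 1 (G n))))) ⟨
    ⊖ (rs ⊗ (substR 1 (χ ⊗ G (suc n)) ⊕ substR 1 (⊖ substR 1 (G n))))
      ≈⟨ 𝕋.-‿cong (𝕋.*-congˡ {rs} (substR-⊕ 1 (χ ⊗ G (suc n)) (⊖ substR 1 (G n)))) ⟨
    ⊖ (rs ⊗ substR 1 (defect n)) ∎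
    where
    open ≈-Reasoning
    G₂  = G (suc (suc n))
    SG₁ = substR 1 (G (suc n))
    SSG = substR 1 (substR 1 (G n))
    Sχ  = substR 1 χ

  defect-order : ∀ n → OrderAtLeast (suc n) (defect (suc n))
  defect-order n =
    order-of-resolvent W (defect (suc n)) _ (defect-recurrence n) (order-⊖ (correction-order n))
    where
    correction-order : ∀ n → OrderAtLeast (suc n) (rs ⊗ substR 1 (defect n))
    correction-order zero    = order-rs⊗ (substR 1 (defect 0))
    correction-order (suc m) =
      order-weaken (order-rs⊗-suc _ (order-substR₁ (defect (suc m)) (defect-order m)))

  chi-G-agree : ∀ k m → suc k ≤ m → χ ⊗ G (suc m) ≈[s≤ k ] substR 1 (G m)
  chi-G-agree k (suc n) (ℕ.s≤s k≤n) a b c c≤k =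
    ℤ.i-j≡0⇒i≡j _ _ (defect-order n a b c (inj₁ (ℕ.s≤s (ℕ.≤-trans c≤k k≤n))))

  prodChi-G-agree : ∀ k i n → suc k ≤ n → prodChi χ i ⊗ G (n ℕ.+ i) ≈[s≤ k ] substR i (G n)
  prodChi-G-agree k zero    n k<n rewrite ℕ.+-identityʳ n = ≈⇒≈[s≤] (𝕋.*-identityˡ (G n))
  prodChi-G-agree k (suc i) n k<n rewrite ℕ.+-suc n i = begin
    prodChi χ i ⊗ substR i χ ⊗ G (suc n ℕ.+ i)
      ≈⟨ ≈⇒≈[s≤] (solve 3 (λ P X Y → P :* X :* Y := X :* (P :* Y))
                          𝕋.refl (prodChi χ i) (substR i χ) (G (suc n ℕ.+ i))) ⟩
    substR i χ ⊗ (prodChi χ i ⊗ G (suc n ℕ.+ i))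
      ≈⟨ ⊗-cong-≈[s≤] (substR i χ) (substR i χ) _ _ (λ _ _ _ _ → refl)
           (prodChi-G-agree k i (suc n) (ℕ.m≤n⇒m≤1+n k<n)) ⟩
    substR i χ ⊗ substR i (G (suc n))
      ≈⟨ ≈⇒≈[s≤] (substR-⊗ i χ (G (suc n))) ⟨
    substR i (χ ⊗ G (suc n))
      ≈⟨ substR-cong-≈[s≤] i _ _ (chi-G-agree k n k<n) ⟩
    substR i (substR 1 (G n))
      ≈⟨ ≈⇒≈[s≤] (substR-substR i 1 (G n)) ⟩
    substR (suc i) (G n) ∎
    where open Relation.Binary.Reasoning.Setoid (≈[s≤]-setoid k)

  EFP-agree : ∀ k i m → suc k ≤ m → EFP (m ℕ.+ i) i ≈[s≤ k ] prodChi χ i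
  EFP-agree k i m k<m rewrite ℕ.m+n∸n≡m m i = begin
    substR i (G m) ⊗ invS Gₘ₊ᵢ
      ≈⟨ ⊗-cong-≈[s≤] _ _ (invS Gₘ₊ᵢ) (invS Gₘ₊ᵢ)
                       (prodChi-G-agree k i m k<m) (λ _ _ _ _ → refl) ⟨
    prodChi χ i ⊗ Gₘ₊ᵢ ⊗ invS Gₘ₊ᵢ
      ≈⟨ ≈⇒≈[s≤] (𝕋.*-assoc (prodChi χ i) Gₘ₊ᵢ (invS Gₘ₊ᵢ)) ⟩
    prodChi χ i ⊗ (Gₘ₊ᵢ ⊗ invS Gₘ₊ᵢ)
      ≈⟨ ≈⇒≈[s≤] (𝕋.*-congˡ {prodChi χ i}
                    (Inverse.invS-inverse Gₘ₊ᵢ (G-at-s⁰ (m ℕ.+ i)))) ⟩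
    prodChi χ i ⊗ one
      ≈⟨ ≈⇒≈[s≤] (𝕋.*-identityʳ (prodChi χ i)) ⟩
    prodChi χ i ∎
    where
    open Relation.Binary.Reasoning.Setoid (≈[s≤]-setoid k)
    Gₘ₊ᵢ = G (m ℕ.+ i)

mainTheorem17 : (χ : T) → IsChi χ → (i : ℕ) → 1 ≤ i →
    (k : ℕ) → ∃[ N ] (∀ n → N ≤ n → i ≤ n →
      ∀ a b → EFP n i a b k ≡ prodChi χ i a b k)
mainTheorem17 χ isChi i _ k = suc k ℕ.+ i , λ n N≤n i≤n a b →
  subst (λ n′ → EFP n′ i a b k ≡ prodChi χ i a b k) (ℕ.m∸n+n≡m i≤n)
    (FunctionalEquation.EFP-agree χ isChi k i (n ∸ i) (ℕ.m+n≤o⇒m≤o∸n (suc k) N≤n) a b k ℕ.≤-refl)
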